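{- Let $G=(V,E)$ be a graph and let $\mathcal{P}=(V_{u,v}\mid (u,v)\in V\times V)$ be a T-partition system on $G$. Then the groupoid associated with $\mathcal{P}$ is a travel groupoid on $G$.
   Context: Graphs are undirected, possibly infinite, with no loops and no multiple edges. For $u\in V$, $N_G[u]=\{u\}\cup\{v\in V\mid \{u,v\}\in E\}$. A T-partition system on $G=(V,E)$ is a family $(V_{u,v}\subseteq V\mid (u,v)\in V\times V)$ such that: (P0) for every $u\in V$, $\{V_{u,v}\mid v\in N_G[u]\}$ is a partition of $V$; (P1a) $V_{u,u}=\{u\}$ for all $u$; (P1b) for $u\neq v$: $v\in V_{u,v}$ iff $\{u,v\}\in E$; (P1c) for $u\neq v$: $V_{u,v}=\emptyset$ iff $\{u,v\}\notin E$; (P2) for $u\neq v$: $V_{u,v}\cap V_{v,u}=\emptyset$. For such a system, for all $u,v\in V$ there is a unique $w$ with $v\in V_{u,w}$; the groupoid associated with the system is $(V,*)$ with $u*v$ defined to be this $w$. A travel groupoid is a set $V\neq\emptyset$ with binary operation $*$ satisfying (t1) $(u*v)*u=u$ for all $u,v$, and (t2) if $(u*v)*v=u$ then $u=v$. A travel groupoid $(V,*)$ is on the graph $G$ if $V(G)=V$ and $E(G)=\{\{u,v\}\mid u,v\in V,\ u\neq v,\ u*v=v\}$. -}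

module Defs where

open import Level using (Level; _⊔_; suc)
open import Data.Product using (Σ; _×_; proj₁)
open import Data.Sum using (_⊎_)
open import Data.Empty using (⊥)
open import Relation.Nullary using (¬_)
open import Relation.Binary.PropositionalEquality using (_≡_; _≢_)
open import Function.Bundles using (_⇔_)

record Graph (a ℓ : Level) : Set (Level.suc (a ⊔ ℓ)) where
  field
    Vtx   : Set a
    Adj   : Vtx → Vtx → Set ℓ
    sym   : ∀ {u v} → Adj u v → Adj v u
    irrefl : ∀ {u} → ¬ Adj u u

module _ {a ℓ : Level} (G : Graph a ℓ) where
  open Graph G

  N[_] : Vtx → Vtx → Set (a ⊔ ℓ)
  N[ u ] w = (w ≡ u) ⊎ Adj u w

  -- A T-partition system: family of subsets V_{u,v} (predicates, x ∈ V_{u,v} is  part u v x).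
  -- (P0) is stated as: for every u, the indexed family (V_{u,w} | w ∈ N[u]) covers V
  -- (with a witness) and its members are pairwise disjoint (distinct indices give
  -- disjoint sets); blocks are nonempty by (P1a)/(P1b), so nonemptiness is listed too.
  record TPartitionSystem (p : Level) : Set (a ⊔ ℓ ⊔ Level.suc p) where
    field
      part   : Vtx → Vtx → Vtx → Set p
      cover    : ∀ u x → Σ Vtx (λ w → N[ u ] w × part u w x)
      disjoint : ∀ u w w' x → N[ u ] w → N[ u ] w' → part u w x → part u w' x → w ≡ w'
      nonempty : ∀ u w → N[ u ] w → Σ Vtx (λ x → part u w x)
      p1a : ∀ u x → part u u x ⇔ (x ≡ u)
      p1b : ∀ u v → u ≢ v → part u v v ⇔ Adj u v
      p1c : ∀ u v → u ≢ v → (∀ x → ¬ part u v x) ⇔ (¬ Adj u v)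
      p2  : ∀ u v → u ≢ v → ∀ x → part u v x → part v u x → ⊥

  -- The groupoid associated with a T-partition system: u * v is the (unique) w
  -- with v ∈ V_{u,w} (w ∈ N[u] by (P0)).
  assocOp : ∀ {p} → TPartitionSystem p → Vtx → Vtx → Vtx
  assocOp P u v = proj₁ (TPartitionSystem.cover P u v)

IsTravelGroupoid : ∀ {a} (V : Set a) → (V → V → V) → Set a
IsTravelGroupoid V _*_ =
  (∀ u v → (u * v) * u ≡ u) ×
  (∀ u v → (u * v) * v ≡ u → u ≡ v)

-- A travel groupoid (V,*) is on G: V(G) = V and
-- E(G) = { {u,v} | u ≠ v, u * v = v }  (unordered pairs).
TravelGroupoidOn : ∀ {a ℓ} (G : Graph a ℓ) → (Graph.Vtx G → Graph.Vtx G → Graph.Vtx G) → Set (a ⊔ ℓ)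
TravelGroupoidOn G _*_ =
  IsTravelGroupoid (Graph.Vtx G) _*_ ×
  (∀ u v → Graph.Adj G u v ⇔ ((u ≢ v × u * v ≡ v) ⊎ (v ≢ u × v * u ≡ u)))

module Submission where

-- Write u * v for the unique w ∈ N[u] with v ∈ V_{u,w}.  Everything rests on
-- one characterisation of the operation (`*-unique`): whenever w ∈ N[u] and
-- v ∈ V_{u,w}, then u * v ≡ w.  From it and the axioms we derive:
--   * u * u ≡ u (by P1a) and u * v ≡ v for every edge {u,v} (by P1b);
--   * for u ≢ v, u * v ≡ v holds exactly when {u,v} is an edge (P1b again);
--   * the return law: w * u ≡ u for every w ∈ N[u], which gives (t1) since
--     u * v ∈ N[u];
--   * no backtracking: if w ∈ N[u], v ∈ V_{u,w} and w * v ≡ u, then u ≡ v,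
--     because otherwise v ∈ V_{u,w} ∩ V_{w,u}, contradicting P2; this is (t2).

open import Defs
open import Level using (Level)
open import Data.Product using (_×_; _,_; proj₁; proj₂)
open import Data.Sum using (_⊎_; inj₁; inj₂)
open import Data.Empty using (⊥-elim)
open import Relation.Binary.PropositionalEquality using (_≡_; _≢_; refl; sym; subst)
open import Function.Bundles using (_⇔_; mk⇔; Equivalence)

module TravelGroupoidOfPartitionSystem
         {a ℓ p : Level} (G : Graph a ℓ) (P : TPartitionSystem G p) where
  open Graph G renaming (sym to Adj-sym)
  open TPartitionSystem P

  _*_ : Vtx → Vtx → Vtx
  _*_ = assocOp G P

  Adj⇒≢ : ∀ {u v} → Adj u v → u ≢ v
  Adj⇒≢ adj refl = irrefl adj

  *-inN : ∀ u v → N[_] G u (u * v)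
  *-inN u v = proj₁ (proj₂ (cover u v))

  *-block : ∀ u v → part u (u * v) v
  *-block u v = proj₂ (proj₂ (cover u v))

  -- By disjointness (P0), u * v is the only index in N[u] whose block holds v.
  *-unique : ∀ u w v → N[_] G u w → part u w v → u * v ≡ w
  *-unique u w v w∈N v∈Vuw = disjoint u (u * v) w v (*-inN u v) w∈N (*-block u v) v∈Vuw

  *-idem : ∀ u → u * u ≡ u
  *-idem u = *-unique u u u (inj₁ refl) (Equivalence.from (p1a u u) refl)

  *-to-self⇔Adj : ∀ u v → u ≢ v → (u * v ≡ v) ⇔ Adj u v
  *-to-self⇔Adj u v u≢v = mk⇔ toAdj fromAdj
    where
    toAdj : u * v ≡ v → Adj u v
    toAdj eq = Equivalence.to (p1b u v u≢v) (subst (λ w → part u w v) eq (*-block u v))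

    fromAdj : Adj u v → u * v ≡ v
    fromAdj adj = *-unique u v v (inj₂ adj) (Equivalence.from (p1b u v u≢v) adj)

  Adj⇒*-to-self : ∀ {u v} → Adj u v → u * v ≡ v
  Adj⇒*-to-self {u} {v} adj = Equivalence.from (*-to-self⇔Adj u v (Adj⇒≢ adj)) adj

  *-return : ∀ u w → N[_] G u w → w * u ≡ u
  *-return u .u (inj₁ refl) = *-idem u
  *-return u w  (inj₂ adj)  = Adj⇒*-to-self (Adj-sym adj)

  -- For w ≡ u this is P1a; for a
  -- neighbour w, w * v ≡ u would put v in V_{u,w} ∩ V_{w,u}, against P2.
  no-backtrack : ∀ u w v → N[_] G u w → part u w v → w * v ≡ u → u ≡ v
  no-backtrack u .u v (inj₁ refl) v∈Vuu _ = sym (Equivalence.to (p1a u v) v∈Vuu)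
  no-backtrack u w  v (inj₂ adj)  v∈Vuw w*v≡u =
    ⊥-elim (p2 u w (Adj⇒≢ adj) v v∈Vuw (subst (λ z → part w z v) w*v≡u (*-block w v)))

  t1 : ∀ u v → (u * v) * u ≡ u
  t1 u v = *-return u (u * v) (*-inN u v)

  t2 : ∀ u v → (u * v) * v ≡ u → u ≡ v
  t2 u v = no-backtrack u (u * v) v (*-inN u v) (*-block u v)

  edges : ∀ u v → Adj u v ⇔ ((u ≢ v × u * v ≡ v) ⊎ (v ≢ u × v * u ≡ u))
  edges u v = mk⇔ (λ adj → inj₁ (Adj⇒≢ adj , Adj⇒*-to-self adj)) fromStep
    where
    fromStep : (u ≢ v × u * v ≡ v) ⊎ (v ≢ u × v * u ≡ u) → Adj u v
    fromStep (inj₁ (u≢v , eq)) = Equivalence.to (*-to-self⇔Adj u v u≢v) eq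
    fromStep (inj₂ (v≢u , eq)) = Adj-sym (Equivalence.to (*-to-self⇔Adj v u v≢u) eq)

lemma3p5 : ∀ {a ℓ p : Level} (G : Graph a ℓ) (P : TPartitionSystem G p) →
    TravelGroupoidOn G (assocOp G P)
lemma3p5 G P = (t1 , t2) , edges
  where open TravelGroupoidOfPartitionSystem G P
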